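{- Let $A$ and $B$ be strings of lengths $n$ and $m$ with $m \le n$, over an alphabet together with the wildcard symbol $\mathsf{?}$, and let $k$ be the total number of wildcards occurring in $A$ and $B$ together. Let $d$ be an integer with $1 \le d < k$ and $d < m$ such that the shifted matching sum of $B$ with shift $d$ is at most $6k$. If for some $0 \le i \le n-m$ the substring $A[i, i+m-1]$ matches $B$, then $\sum_{j=i}^{i+m-d-1} \mathbb{S}(A,d)_j \le 8k$.
   Context: Strings are indexed from $0$; $X[\alpha,\beta]$ is the substring of $X$ from index $\alpha$ to $\beta$ inclusive. Two characters match if they are equal or at least one of them is the wildcard $\mathsf{?}$; two strings match if they have equal length and match index by index. For a string $X$ of length $\ell$ and a shift $1 \le d < \ell$, the shifted matching array $\mathbb{S}(X,d)$ is the 0/1 array of length $\ell-d$ with $\mathbb{S}(X,d)_i = 0$ if $X_i = X_{i+d}$ and $X_i \ne \mathsf{?}$, and $\mathbb{S}(X,d)_i = 1$ otherwise (i.e. if $X_i=\mathsf{?}$ or $X_{i+d}=\mathsf{?}$ or $X_i\ne X_{i+d}$). The shifted matching sum of $X$ with shift $d$ is $\sum_{i=0}^{\ell-d-1}\mathbb{S}(X,d)_i$. -}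

module Defs where

open import Data.Nat using (ℕ; zero; suc; _+_; _∸_; _<_; _<?_)
import Data.Fin
open import Data.Fin using (Fin; fromℕ<)
open import Data.Maybe using (Maybe; just; nothing)
open import Relation.Nullary using (Dec; yes; no)
open import Relation.Binary.PropositionalEquality using (_≡_)
open import Relation.Binary using (DecidableEquality)

-- A symbol over alphabet Σ: `just a` is the letter a, `nothing` is the wildcard ?.
Sym : Set → Set
Sym Σ = Maybe Σ

Str : Set → ℕ → Set
Str Σ ℓ = Fin ℓ → Sym Σ

data SymMatch {Σ : Set} : Sym Σ → Sym Σ → Set where
  wildˡ : ∀ {y} → SymMatch nothing y
  wildʳ : ∀ {x} → SymMatch x nothing
  same  : ∀ {a} → SymMatch (just a) (just a)

countWild : {Σ : Set} (ℓ : ℕ) → Str Σ ℓ → ℕ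
countWild zero X = 0
countWild (suc ℓ) X with X Data.Fin.zero
... | nothing = suc (countWild ℓ (λ i → X (Data.Fin.suc i)))
... | just _  = countWild ℓ (λ i → X (Data.Fin.suc i))

-- Symbol at a natural-number position (total; out-of-range positions give
-- the wildcard, but the statement only ever reads in-range positions).
at : {Σ : Set} {ℓ : ℕ} → Str Σ ℓ → ℕ → Sym Σ
at {ℓ = ℓ} X p with p <? ℓ
... | yes p<ℓ = X (fromℕ< p<ℓ)
... | no  _   = nothing

shiftEntry : {Σ : Set} → DecidableEquality Σ → {ℓ : ℕ} → Str Σ ℓ → ℕ → ℕ → ℕ
shiftEntry _≟_ X d i with at X i | at X (i + d)
... | just a  | just b with a ≟ b
...   | yes _ = 0
...   | no  _ = 1
shiftEntry _≟_ X d i | just _  | nothing = 1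
shiftEntry _≟_ X d i | nothing | _       = 1

sumFrom : ℕ → ℕ → (ℕ → ℕ) → ℕ
sumFrom s zero    f = 0
sumFrom s (suc c) f = f s + sumFrom (suc s) c f

shiftedMatchingSum : {Σ : Set} → DecidableEquality Σ → {ℓ : ℕ} → Str Σ ℓ → ℕ → ℕ
shiftedMatchingSum _≟_ {ℓ} X d = sumFrom 0 (ℓ ∸ d) (shiftEntry _≟_ X d)

-- A[i, i+m-1] matches B (requires i + m ≤ n, imposed separately).
SubMatch : {Σ : Set} {n m : ℕ} → Str Σ n → ℕ → Str Σ m → Set
SubMatch {m = m} A i B = (j : Fin m) → SymMatch (at A (i + Data.Fin.toℕ j)) (B j)

-- Inside the window, matching letters of A and B agree, so 𝕊(A,d) can exceed
-- 𝕊(B,d) only where A has a wildcard at one of the two compared positions.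
-- Summing, the window sum of 𝕊(A,d) is at most the shifted matching sum of B
-- plus two windowed wildcard counts of A, each at most k: 6k + k + k.
module Submission where

open import Defs
open import Data.Nat using (ℕ; _+_; _∸_; _*_; _≤_; _<_; zero; suc; _<?_; z≤n; s≤s)
open import Data.Nat.Properties
open import Algebra.Properties.CommutativeSemigroup +-commutativeSemigroup
  using (interchange; xy∙z≈xz∙y; x∙yz≈xz∙y)
open import Data.Maybe using (just; nothing)
import Data.Fin as Fin
open import Data.Fin using (fromℕ<)
open import Data.Fin.Properties using (toℕ-fromℕ<)
open import Function using (_∘_)
open import Relation.Nullary using (yes; no)
open import Relation.Nullary.Negation using (contradiction)
open import Relation.Binary using (DecidableEquality)
open import Relation.Binary.PropositionalEquality
  using (_≡_; refl; sym; trans; cong; cong₂; subst; module ≡-Reasoning)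

sumFrom-suc : ∀ s c (f : ℕ → ℕ) → sumFrom (suc s) c f ≡ sumFrom s c (f ∘ suc)
sumFrom-suc s zero    f = refl
sumFrom-suc s (suc c) f = cong (f (suc s) +_) (sumFrom-suc (suc s) c f)

sumFrom-shift : ∀ s c (f : ℕ → ℕ) → sumFrom s c f ≡ sumFrom 0 c (λ j → f (s + j))
sumFrom-shift zero    c f = refl
sumFrom-shift (suc s) c f = trans (sumFrom-suc s c f) (sumFrom-shift s c (f ∘ suc))

sumFrom-cong : ∀ s c {f g : ℕ → ℕ} → (∀ p → f p ≡ g p) → sumFrom s c f ≡ sumFrom s c g
sumFrom-cong s zero    f≗g = refl
sumFrom-cong s (suc c) f≗g = cong₂ _+_ (f≗g s) (sumFrom-cong (suc s) c f≗g)

sumFrom-mono : ∀ s c {f g : ℕ → ℕ} → (∀ j → j < c → f (s + j) ≤ g (s + j)) →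
               sumFrom s c f ≤ sumFrom s c g
sumFrom-mono s zero    f≤g = z≤n
sumFrom-mono s (suc c) {f} {g} f≤g =
  +-mono-≤ (subst (λ p → f p ≤ g p) (+-identityʳ s) (f≤g 0 (s≤s z≤n)))
           (sumFrom-mono (suc s) c λ j j<c →
              subst (λ p → f p ≤ g p) (+-suc s j) (f≤g (suc j) (s≤s j<c)))

sumFrom-+ : ∀ s c (f g : ℕ → ℕ) →
            sumFrom s c (λ p → f p + g p) ≡ sumFrom s c f + sumFrom s c g
sumFrom-+ s zero    f g = refl
sumFrom-+ s (suc c) f g =
  trans (cong (f s + g s +_) (sumFrom-+ (suc s) c f g))
        (interchange (f s) (g s) (sumFrom (suc s) c f) (sumFrom (suc s) c g))

sumFrom-++ : ∀ s a b (f : ℕ → ℕ) →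
             sumFrom s (a + b) f ≡ sumFrom s a f + sumFrom (s + a) b f
sumFrom-++ s zero    b f = cong (λ t → sumFrom t b f) (sym (+-identityʳ s))
sumFrom-++ s (suc a) b f = begin
  f s + sumFrom (suc s) (a + b) f                          ≡⟨ cong (f s +_) (sumFrom-++ (suc s) a b f) ⟩
  f s + (sumFrom (suc s) a f + sumFrom (suc s + a) b f)    ≡⟨ sym (+-assoc (f s) _ _) ⟩
  f s + sumFrom (suc s) a f + sumFrom (suc s + a) b f      ≡⟨ cong (λ t → f s + sumFrom (suc s) a f + sumFrom t b f) (sym (+-suc s a)) ⟩
  f s + sumFrom (suc s) a f + sumFrom (s + suc a) b f      ∎
  where open ≡-Reasoning

sumFrom-window-≤ : ∀ s c ℓ (f : ℕ → ℕ) → s + c ≤ ℓ → sumFrom s c f ≤ sumFrom 0 ℓ f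
sumFrom-window-≤ s c ℓ f s+c≤ℓ = begin
  sumFrom s c f                                        ≤⟨ m≤n+m _ _ ⟩
  sumFrom 0 s f + sumFrom s c f                        ≤⟨ m≤m+n _ _ ⟩
  sumFrom 0 s f + sumFrom s c f + sumFrom (s + c) r f  ≡⟨ cong (_+ sumFrom (s + c) r f) (sym (sumFrom-++ 0 s c f)) ⟩
  sumFrom 0 (s + c) f + sumFrom (s + c) r f            ≡⟨ sym (sumFrom-++ 0 (s + c) r f) ⟩
  sumFrom 0 (s + c + r) f                              ≡⟨ cong (λ t → sumFrom 0 t f) (m+[n∸m]≡n s+c≤ℓ) ⟩
  sumFrom 0 ℓ f                                        ∎
  where
  open ≤-Reasoning
  r = ℓ ∸ (s + c)

module _ {Σ : Set} where

  wild : Sym Σ → ℕ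
  wild nothing  = 1
  wild (just _) = 0

  at-< : ∀ {ℓ} (X : Str Σ ℓ) {p} (p<ℓ : p < ℓ) → at X p ≡ X (fromℕ< p<ℓ)
  at-< {ℓ} X {p} p<ℓ with p <? ℓ
  ... | yes _   = refl
  ... | no p≮ℓ = contradiction p<ℓ p≮ℓ

  at-suc : ∀ {ℓ} (X : Str Σ (suc ℓ)) p → at X (suc p) ≡ at (X ∘ Fin.suc) p
  at-suc {ℓ} X p with suc p <? suc ℓ | p <? ℓ
  ... | yes _         | yes _   = refl
  ... | yes (s≤s p<ℓ) | no p≮ℓ  = contradiction p<ℓ p≮ℓ
  ... | no sp≮sℓ      | yes p<ℓ = contradiction (s≤s p<ℓ) sp≮sℓ
  ... | no _          | no _    = refl

  countWild-suc : ∀ ℓ (X : Str Σ (suc ℓ)) →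
                  countWild (suc ℓ) X ≡ wild (X Fin.zero) + countWild ℓ (X ∘ Fin.suc)
  countWild-suc ℓ X with X Fin.zero
  ... | nothing = refl
  ... | just _  = refl

  countWild-sumFrom : ∀ ℓ (X : Str Σ ℓ) → countWild ℓ X ≡ sumFrom 0 ℓ (wild ∘ at X)
  countWild-sumFrom zero    X = refl
  countWild-sumFrom (suc ℓ) X = begin
    countWild (suc ℓ) X                              ≡⟨ countWild-suc ℓ X ⟩
    wild (X Fin.zero) + countWild ℓ X′               ≡⟨ cong₂ _+_ (cong wild (sym (at-< X (s≤s z≤n))))
                                                                   (countWild-sumFrom ℓ X′) ⟩
    wild (at X 0) + sumFrom 0 ℓ (wild ∘ at X′)       ≡⟨ cong (wild (at X 0) +_) (sym tail) ⟩
    wild (at X 0) + sumFrom 1 ℓ (wild ∘ at X)        ∎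
    where
    open ≡-Reasoning
    X′ = X ∘ Fin.suc
    tail : sumFrom 1 ℓ (wild ∘ at X) ≡ sumFrom 0 ℓ (wild ∘ at X′)
    tail = trans (sumFrom-suc 0 ℓ _) (sumFrom-cong 0 ℓ (cong wild ∘ at-suc X))

  wild-window-≤ : ∀ ℓ (X : Str Σ ℓ) s c → s + c ≤ ℓ →
                  sumFrom 0 c (λ j → wild (at X (s + j))) ≤ countWild ℓ X
  wild-window-≤ ℓ X s c s+c≤ℓ = begin
    sumFrom 0 c (λ j → wild (at X (s + j)))  ≡⟨ sumFrom-shift s c (wild ∘ at X) ⟨
    sumFrom s c (wild ∘ at X)                ≤⟨ sumFrom-window-≤ s c ℓ _ s+c≤ℓ ⟩
    sumFrom 0 ℓ (wild ∘ at X)                ≡⟨ countWild-sumFrom ℓ X ⟨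
    countWild ℓ X                            ∎
    where open ≤-Reasoning

  subMatch-at : ∀ {n m} (A : Str Σ n) (B : Str Σ m) i → SubMatch A i B →
                ∀ {j} → j < m → SymMatch (at A (i + j)) (at B j)
  subMatch-at A B i M {j} j<m rewrite at-< B j<m =
    subst (λ p → SymMatch (at A (i + p)) (B (fromℕ< j<m))) (toℕ-fromℕ< j<m) (M (fromℕ< j<m))

  module _ (_≟_ : DecidableEquality Σ) where

    mismatch : Sym Σ → Sym Σ → ℕ
    mismatch (just a) (just b) with a ≟ b
    ... | yes _ = 0
    ... | no  _ = 1
    mismatch (just _) nothing = 1
    mismatch nothing  _       = 1

    mismatch-≤1 : ∀ x y → mismatch x y ≤ 1
    mismatch-≤1 (just a) (just b) with a ≟ b
    ... | yes _ = z≤n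
    ... | no  _ = s≤s z≤n
    mismatch-≤1 (just _) nothing = s≤s z≤n
    mismatch-≤1 nothing  _       = s≤s z≤n

    mismatch-≤ : ∀ {a a′ b b′} → SymMatch a b → SymMatch a′ b′ →
                 mismatch a a′ ≤ wild a + wild a′ + mismatch b b′
    mismatch-≤ {nothing}          _     _     = s≤s z≤n
    mismatch-≤ {just _} {nothing} _     _     = s≤s z≤n
    mismatch-≤ {just a} {just a′} wildʳ _     = mismatch-≤1 (just a) (just a′)
    mismatch-≤ {just a} {just a′} same  wildʳ = mismatch-≤1 (just a) (just a′)
    mismatch-≤ same same = ≤-refl

    shiftEntry-mismatch : ∀ {ℓ} (X : Str Σ ℓ) d p →
                          shiftEntry _≟_ X d p ≡ mismatch (at X p) (at X (p + d))
    shiftEntry-mismatch X d p with at X p | at X (p + d)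
    ... | just a  | just b with a ≟ b
    ...   | yes _ = refl
    ...   | no  _ = refl
    shiftEntry-mismatch X d p | just _  | nothing = refl
    shiftEntry-mismatch X d p | nothing | _       = refl

    shiftEntry-subMatch-≤ : ∀ {n m} (A : Str Σ n) (B : Str Σ m) i → SubMatch A i B →
                            ∀ d j → j + d < m →
                            shiftEntry _≟_ A d (i + j)
                              ≤ wild (at A (i + j)) + wild (at A (i + d + j)) + shiftEntry _≟_ B d j
    shiftEntry-subMatch-≤ A B i M d j j+d<m
      rewrite shiftEntry-mismatch A d (i + j) | shiftEntry-mismatch B d j | xy∙z≈xz∙y i j d =
      mismatch-≤ (subMatch-at A B i M (≤-trans (s≤s (m≤m+n j d)) j+d<m))
                 (subst (λ p → SymMatch (at A p) (at B (j + d))) (x∙yz≈xz∙y i j d) (subMatch-at A B i M j+d<m))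

lemma2 : {Σ : Set} (_≟_ : DecidableEquality Σ) (n m : ℕ) (A : Str Σ n) (B : Str Σ m)
         → m ≤ n
         → (k d : ℕ) → k ≡ countWild n A + countWild m B
         → 1 ≤ d → d < k → d < m
         → shiftedMatchingSum _≟_ B d ≤ 6 * k
         → (i : ℕ) → i ≤ n ∸ m
         → SubMatch A i B
         → sumFrom i (m ∸ d) (shiftEntry _≟_ A d) ≤ 8 * k
lemma2 _≟_ n m A B m≤n k d refl _ _ d<m B-sum≤ i i≤n∸m M = begin
  sumFrom i c SA                                          ≡⟨ sumFrom-shift i c SA ⟩
  sumFrom 0 c (λ j → SA (i + j))                          ≤⟨ sumFrom-mono 0 c pointwise ⟩
  sumFrom 0 c (λ j → wA (i + j) + wA (i + d + j) + SB j)  ≡⟨ split ⟩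
  window i + window (i + d) + sumFrom 0 c SB              ≤⟨ +-mono-≤ (+-mono-≤ (window-≤ i i+c≤n)
                                                                                (window-≤ (i + d) i+d+c≤n))
                                                                      B-sum≤ ⟩
  k + k + 6 * k                                           ≡⟨ +-assoc k k (6 * k) ⟩
  8 * k                                                   ∎
  where
  open ≤-Reasoning
  c = m ∸ d
  SA = shiftEntry _≟_ A d
  SB = shiftEntry _≟_ B d
  wA = wild ∘ at A

  window : ℕ → ℕ
  window s = sumFrom 0 c (λ j → wA (s + j))

  window-≤ : ∀ s → s + c ≤ n → window s ≤ k
  window-≤ s s+c≤n = ≤-trans (wild-window-≤ n A s c s+c≤n) (m≤m+n _ _)

  pointwise : ∀ j → j < c → SA (i + j) ≤ wA (i + j) + wA (i + d + j) + SB j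
  pointwise j j<c = shiftEntry-subMatch-≤ _≟_ A B i M d j
                      (≤-trans (+-monoˡ-< d j<c) (≤-reflexive (m∸n+n≡m (<⇒≤ d<m))))

  split : sumFrom 0 c (λ j → wA (i + j) + wA (i + d + j) + SB j) ≡ window i + window (i + d) + sumFrom 0 c SB
  split = trans (sumFrom-+ 0 c _ SB) (cong (_+ sumFrom 0 c SB) (sumFrom-+ 0 c _ _))

  i+m≤n : i + m ≤ n
  i+m≤n = ≤-trans (+-monoˡ-≤ m i≤n∸m) (≤-reflexive (m∸n+n≡m m≤n))

  i+c≤n : i + c ≤ n
  i+c≤n = ≤-trans (+-monoʳ-≤ i (m∸n≤m m d)) i+m≤n

  i+d+c≤n : i + d + c ≤ n
  i+d+c≤n = ≤-trans (≤-reflexive (trans (+-assoc i d c) (cong (i +_) (m+[n∸m]≡n (<⇒≤ d<m))))) i+m≤n
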